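{- For every finite graph $G$, $\chi_{um}(G)\le 2^{\chi_{cf}(G)}-1$.
   Context: A path in a graph is a simple path (a single vertex counts as a path). A unique-maximum coloring of $G=(V,E)$ with $k$ colors is a function $C\colon V\to\{1,\dots,k\}$ such that on the vertex set of every path of $G$ the maximum color occurs exactly once; $\chi_{um}(G)$ is the minimum $k$ for which such a coloring exists. A conflict-free coloring of $G$ with $k$ colors is a function $C\colon V\to\{1,\dots,k\}$ such that for every path of $G$ some color occurs exactly once on its vertices; $\chi_{cf}(G)$ is the minimum such $k$. -}

module Defs where

open import Data.Nat using (ℕ; zero; suc; _≤_; _⊔_)
open import Data.Nat.Properties using (_≟_)
open import Data.Fin using (Fin)
open import Data.List using (List; []; _∷_; map; foldr)
open import Data.List.Relation.Unary.Linked using (Linked)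
open import Data.List.Relation.Unary.Unique.Propositional using (Unique)
open import Data.Product using (_×_; ∃)
open import Relation.Binary.PropositionalEquality using (_≡_)
open import Relation.Nullary using (¬_; yes; no)

record Graph (n : ℕ) : Set₁ where
  field
    Adj       : Fin n → Fin n → Set
    symmetric : ∀ {u v} → Adj u v → Adj v u
    irreflex  : ∀ {v} → ¬ Adj v v
open Graph public

record IsPath {n : ℕ} (G : Graph n) (P : List (Fin n)) : Set where
  field
    nonempty : ¬ (P ≡ [])
    distinct : Unique P
    linked   : Linked (Adj G) P

countColor : {n : ℕ} → (Fin n → ℕ) → ℕ → List (Fin n) → ℕ
countColor C c [] = 0
countColor C c (v ∷ P) with C v ≟ c
... | yes _ = suc (countColor C c P)
... | no  _ = countColor C c P

maxColor : {n : ℕ} → (Fin n → ℕ) → List (Fin n) → ℕ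
maxColor C P = foldr _⊔_ 0 (map C P)

UsesColors : {n : ℕ} → ℕ → (Fin n → ℕ) → Set
UsesColors k C = ∀ v → (1 ≤ C v) × (C v ≤ k)

IsUMColoring : {n : ℕ} → Graph n → ℕ → (Fin n → ℕ) → Set
IsUMColoring G k C =
  UsesColors k C × (∀ P → IsPath G P → countColor C (maxColor C P) P ≡ 1)

IsCFColoring : {n : ℕ} → Graph n → ℕ → (Fin n → ℕ) → Set
IsCFColoring G k C =
  UsesColors k C × (∀ P → IsPath G P → ∃ λ c → countColor C c P ≡ 1)

IsχUM : {n : ℕ} → Graph n → ℕ → Set₀
IsχUM G k = (∃ λ C → IsUMColoring G k C) × (∀ j → (∃ λ C → IsUMColoring G j C) → k ≤ j)

IsχCF : {n : ℕ} → Graph n → ℕ → Set₀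
IsχCF G k = (∃ λ C → IsCFColoring G k C) × (∀ j → (∃ λ C → IsCFColoring G j C) → k ≤ j)

-- A conflict-free colouring with b colours admits no path on 2^b vertices: the colour that
-- occurs once on a path splits it into two paths avoiding that colour, so induction on the
-- number of colours bounds every path by 2^b - 1 vertices.
--
-- In a depth-first search forest adjacent vertices are in ancestor relation, so every path has
-- a unique shallowest vertex, of which all its other vertices are descendants.  Colouring v by
-- 2^b - depth v is therefore a unique-maximum colouring, and it uses at most 2^b - 1 colours
-- because the branch from v to its root is a path.  The search next visits a neighbour of the
-- topmost stack vertex that still has unvisited neighbours; adjacent vertices become comparable
-- because a path of unvisited vertices touching a stack vertex x ends up entirely below x.
--
-- The search needs adjacency to be decidable; since the conclusion is a decidable inequality,
-- the double negation of that decidability is enough.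

module Submission where

open import Defs
open import Data.Nat using (ℕ; zero; suc; _≤_; _<_; _^_; _∸_; _+_; _*_; z≤n; s≤s)
open import Data.Nat.Properties
open import Data.Fin using (Fin)
import Data.Fin as Fin
open import Data.Fin.Properties using (sequence)
open import Data.List using (List; []; _∷_; _++_; length; filter; allFin; applyUpTo)
open import Data.List.Properties using (length-++; length-tabulate; length-applyUpTo; filter-notAll; ∷-injective)
open import Data.List.Membership.Propositional using (_∈_; _∉_; find; lose)
open import Data.List.Membership.Propositional.Properties
  using (∈-++⁺ˡ; ∈-++⁺ʳ; ∈-++⁻; ∈-∃++; ∈-filter⁺; ∈-filter⁻; ∈-allFin; ∈-applyUpTo⁺)
open import Data.List.Relation.Binary.Disjoint.Propositional using (Disjoint)
open import Data.List.Relation.Binary.Subset.Propositional using (_⊆_)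
open import Data.List.Relation.Unary.Any using (Any; here; there; any?)
import Data.List.Relation.Unary.All as All
import Data.List.Relation.Unary.All.Properties as Allₚ
open import Data.List.Relation.Unary.Linked using (Linked; []; [-]; _∷_)
import Data.List.Relation.Unary.Linked as Linked
open import Data.List.Relation.Unary.Unique.Propositional using (Unique)
open import Data.List.Relation.Unary.Unique.Propositional.Properties using (Unique[x∷xs]⇒x∉xs)
open import Data.List.Relation.Unary.AllPairs using ([]; _∷_)
open import Data.Product using (_×_; _,_; ∃; proj₁; proj₂)
open import Data.Sum using (_⊎_; inj₁; inj₂)
open import Effect.Monad using (RawMonad)
open import Function using (_∘_; case_of_)
open import Relation.Binary.Core using (Rel)
open import Relation.Binary.Definitions using (Decidable)
open import Relation.Binary.PropositionalEquality
open import Relation.Nullary using (¬_; Dec; yes; no; ¬?; contradiction)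
open import Relation.Nullary.Decidable using (decidable-stable; ¬¬-excluded-middle)
open import Relation.Nullary.Negation using (¬¬-Monad; ¬¬-map)

module _ {a r} {A : Set a} {R : Rel A r} where

  Linked-++⁻ˡ : ∀ xs {ys} → Linked R (xs ++ ys) → Linked R xs
  Linked-++⁻ˡ []           _       = []
  Linked-++⁻ˡ (x ∷ [])     _       = [-]
  Linked-++⁻ˡ (x ∷ y ∷ xs) (r ∷ l) = r ∷ Linked-++⁻ˡ (y ∷ xs) l

  Linked-++⁻ʳ : ∀ xs {ys} → Linked R (xs ++ ys) → Linked R ys
  Linked-++⁻ʳ []       l = l
  Linked-++⁻ʳ (x ∷ xs) l = Linked-++⁻ʳ xs (Linked.tail l)

  Linked-++-last : ∀ x xs {y ys} → Linked R (x ∷ xs ++ y ∷ ys) → Any (λ z → R z y) (x ∷ xs)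
  Linked-++-last x []        (r ∷ _) = here r
  Linked-++-last x (x′ ∷ xs) (_ ∷ l) = there (Linked-++-last x′ xs l)

module _ {a} {A : Set a} where

  Unique-++⁻ˡ : ∀ xs {ys : List A} → Unique (xs ++ ys) → Unique xs
  Unique-++⁻ˡ []       _        = []
  Unique-++⁻ˡ (x ∷ xs) (x∉ ∷ u) = Allₚ.++⁻ˡ xs x∉ ∷ Unique-++⁻ˡ xs u

  Unique-++⁻ʳ : ∀ xs {ys : List A} → Unique (xs ++ ys) → Unique ys
  Unique-++⁻ʳ []       u       = u
  Unique-++⁻ʳ (x ∷ xs) (_ ∷ u) = Unique-++⁻ʳ xs u

  Unique-++⇒Disjoint : ∀ xs {ys : List A} → Unique (xs ++ ys) → Disjoint xs ys
  Unique-++⇒Disjoint (x ∷ xs) (x∉ ∷ _) (here refl , v∈ys) = All.lookup (Allₚ.++⁻ʳ xs x∉) v∈ys refl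
  Unique-++⇒Disjoint (x ∷ xs) (_ ∷ u)  (there v∈xs , v∈ys) = Unique-++⇒Disjoint xs u (v∈xs , v∈ys)

  Unique-∷ : ∀ {x} {xs : List A} → x ∉ xs → Unique xs → Unique (x ∷ xs)
  Unique-∷ {xs = xs} x∉xs u = Allₚ.¬Any⇒All¬ xs x∉xs ∷ u

  length-≤-++ : ∀ xs {ys : List A} → length ys ≤ length (xs ++ ys)
  length-≤-++ xs {ys} = ≤-trans (m≤n+m (length ys) (length xs)) (≤-reflexive (sym (length-++ xs)))

  ++-suffix-≤ : ∀ (xs ys : List A) {zs ws} → xs ++ zs ≡ ys ++ ws →
                length ws ≤ length zs → ∃ λ vs → zs ≡ vs ++ ws
  ++-suffix-≤ []       ys       eq _ = ys , eq
  ++-suffix-≤ (x ∷ xs) []       refl ws≤zs = contradiction ws≤zs (<⇒≱ (s≤s (length-≤-++ xs)))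
  ++-suffix-≤ (x ∷ xs) (y ∷ ys) eq ws≤zs = ++-suffix-≤ xs ys (proj₂ (∷-injective eq)) ws≤zs

module _ {n : ℕ} (G : Graph n) where

  IsPath-∷ : ∀ {x xs} → Unique (x ∷ xs) → Linked (Adj G) (x ∷ xs) → IsPath G (x ∷ xs)
  IsPath-∷ u l = record { nonempty = λ () ; distinct = u ; linked = l }

  IsPath-length>0 : ∀ {P} → IsPath G P → 0 < length P
  IsPath-length>0 {[]}    P = contradiction refl (IsPath.nonempty P)
  IsPath-length>0 {_ ∷ _} _ = s≤s z≤n

  IsPath-++⁻ˡ : ∀ x xs {ys} → IsPath G (x ∷ xs ++ ys) → IsPath G (x ∷ xs)
  IsPath-++⁻ˡ x xs P = IsPath-∷ (Unique-++⁻ˡ (x ∷ xs) (IsPath.distinct P))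
                                (Linked-++⁻ˡ (x ∷ xs) (IsPath.linked P))

  IsPath-++⁻ʳ : ∀ xs {y ys} → IsPath G (xs ++ y ∷ ys) → IsPath G (y ∷ ys)
  IsPath-++⁻ʳ xs P = IsPath-∷ (Unique-++⁻ʳ xs (IsPath.distinct P)) (Linked-++⁻ʳ xs (IsPath.linked P))

  path-side : ∀ {P u z} → IsPath G P → u ∈ P → z ∈ P → z ≢ u →
              ∃ λ Q → IsPath G Q × z ∈ Q × Q ⊆ P × u ∉ Q × Any (λ y → Adj G y u) Q
  path-side {u = u} {z} P u∈P z∈P z≢u with xs , ys , refl ← ∈-∃++ u∈P = side xs ys P (∈-++⁻ xs z∈P)
    where
      side : ∀ xs ys → IsPath G (xs ++ u ∷ ys) → (z ∈ xs ⊎ z ∈ u ∷ ys) →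
             ∃ λ Q → IsPath G Q × z ∈ Q × Q ⊆ xs ++ u ∷ ys × u ∉ Q × Any (λ y → Adj G y u) Q
      side (w ∷ ws) ys P (inj₁ z∈xs) =
        w ∷ ws , IsPath-++⁻ˡ w ws P , z∈xs , ∈-++⁺ˡ ,
        (λ u∈xs → Unique-++⇒Disjoint (w ∷ ws) (IsPath.distinct P) (u∈xs , here refl)) ,
        Linked-++-last w ws (IsPath.linked P)
      side xs ys P (inj₂ (here z≡u)) = contradiction z≡u z≢u
      side xs (w ∷ ws) P (inj₂ (there z∈ys)) =
        w ∷ ws , IsPath-++⁻ʳ (u ∷ []) uP , z∈ys , ∈-++⁺ʳ xs ∘ there ,
        Unique[x∷xs]⇒x∉xs (IsPath.distinct uP) ,
        here (symmetric G (Linked.head (IsPath.linked uP)))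
        where
          uP : IsPath G (u ∷ w ∷ ws)
          uP = IsPath-++⁻ʳ xs P

module _ {n : ℕ} (C : Fin n → ℕ) where

  countColor-∷-≡ : ∀ {c v} P → C v ≡ c → countColor C c (v ∷ P) ≡ suc (countColor C c P)
  countColor-∷-≡ {c} {v} P Cv≡c with C v ≟ c
  ... | yes _    = refl
  ... | no Cv≢c = contradiction Cv≡c Cv≢c

  countColor-∷-≢ : ∀ {c v} P → C v ≢ c → countColor C c (v ∷ P) ≡ countColor C c P
  countColor-∷-≢ {c} {v} P Cv≢c with C v ≟ c
  ... | yes Cv≡c = contradiction Cv≡c Cv≢c
  ... | no _     = refl

  countColor-≡0 : ∀ {c} P → (∀ {y} → y ∈ P → C y ≢ c) → countColor C c P ≡ 0
  countColor-≡0 []      _     = refl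
  countColor-≡0 (v ∷ P) avoid =
    trans (countColor-∷-≢ P (avoid (here refl))) (countColor-≡0 P (avoid ∘ there))

  countColor-≡0⁻ : ∀ {c} P → countColor C c P ≡ 0 → ∀ {y} → y ∈ P → C y ≢ c
  countColor-≡0⁻ {c} (v ∷ P) none y∈ Cy≡c with C v ≟ c | y∈
  ... | yes _ | _          = case none of λ ()
  ... | no Cv≢c | here refl = Cv≢c Cy≡c
  ... | no _  | there y∈P  = countColor-≡0⁻ P none y∈P Cy≡c

  countColor-≡1-split : ∀ {c} P → countColor C c P ≡ 1 →
    ∃ λ A → ∃ λ v → ∃ λ B → P ≡ A ++ v ∷ B × C v ≡ c ×
      (∀ {y} → y ∈ A → C y ≢ c) × (∀ {y} → y ∈ B → C y ≢ c)
  countColor-≡1-split {c} (v ∷ P) once with C v ≟ c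
  ... | yes Cv≡c = [] , v , P , refl , Cv≡c , (λ ()) , countColor-≡0⁻ P (suc-injective once)
  ... | no Cv≢c with A , w , B , refl , Cw≡c , A-avoids , B-avoids ← countColor-≡1-split P once =
    v ∷ A , w , B , refl , Cw≡c , avoid , B-avoids
    where
      avoid : ∀ {y} → y ∈ v ∷ A → C y ≢ c
      avoid (here refl) = Cv≢c
      avoid (there y∈A) = A-avoids y∈A

  countColor-≡1 : ∀ {c x} P → Unique P → x ∈ P → C x ≡ c →
                  (∀ {y} → y ∈ P → y ≢ x → C y ≢ c) → countColor C c P ≡ 1
  countColor-≡1 (v ∷ P) (v∉ ∷ _) (here refl) Cx≡c others =
    trans (countColor-∷-≡ P Cx≡c)
          (cong suc (countColor-≡0 P (λ y∈P → others (there y∈P) (All.lookup v∉ y∈P ∘ sym))))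
  countColor-≡1 (v ∷ P) (v∉ ∷ u) (there x∈P) Cx≡c others =
    trans (countColor-∷-≢ P (others (here refl) (λ { refl → All.lookup v∉ x∈P refl })))
          (countColor-≡1 P u x∈P Cx≡c (others ∘ there))

  ≤-maxColor : ∀ {x} P → x ∈ P → C x ≤ maxColor C P
  ≤-maxColor (v ∷ P) (here refl) = m≤m⊔n (C v) (maxColor C P)
  ≤-maxColor (v ∷ P) (there x∈P) = ≤-trans (≤-maxColor P x∈P) (m≤n⊔m (C v) (maxColor C P))

  maxColor-≤ : ∀ {m} P → (∀ {y} → y ∈ P → C y ≤ m) → maxColor C P ≤ m
  maxColor-≤ []      _     = z≤n
  maxColor-≤ (v ∷ P) bound = ⊔-lub (bound (here refl)) (maxColor-≤ P (bound ∘ there))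

  countColor-maxColor : ∀ {x} P → Unique P → x ∈ P → (∀ {y} → y ∈ P → y ≢ x → C y < C x) →
                        countColor C (maxColor C P) P ≡ 1
  countColor-maxColor {x} P u x∈P smaller =
    countColor-≡1 P u x∈P (sym max≡Cx) (λ y∈P y≢x → <⇒≢ (subst (_ <_) (sym max≡Cx) (smaller y∈P y≢x)))
    where
      ≤Cx : ∀ {y} → y ∈ P → C y ≤ C x
      ≤Cx {y} y∈P with y Fin.≟ x
      ... | yes refl = ≤-refl
      ... | no y≢x   = <⇒≤ (smaller y∈P y≢x)
      max≡Cx : maxColor C P ≡ C x
      max≡Cx = ≤-antisym (maxColor-≤ P ≤Cx) (≤-maxColor P x∈P)

length-++-∷-< : ∀ {a} {A : Set a} (xs : List A) {y ys m} →
                length xs < m → length ys < m → length (xs ++ y ∷ ys) < 2 * m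
length-++-∷-< xs {ys = ys} {m} xs<m ys<m = begin-strict
  length (xs ++ _ ∷ ys)        ≡⟨ length-++ xs ⟩
  length xs + suc (length ys)  <⟨ +-mono-≤ xs<m ys<m ⟩
  m + m                        ≡⟨ cong (m +_) (sym (+-identityʳ m)) ⟩
  2 * m                        ∎
  where open ≤-Reasoning

module _ {n : ℕ} (G : Graph n) (C : Fin n → ℕ)
         (conflict-free : ∀ P → IsPath G P → ∃ λ c → countColor C c P ≡ 1) where

  length<2^palette : ∀ k (palette : List ℕ) → length palette ≤ k →
    ∀ P → Unique P → Linked (Adj G) P → (∀ {v} → v ∈ P → C v ∈ palette) → length P < 2 ^ k
  length<2^palette k _ _ [] _ _ _ = m^n>0 2 k
  length<2^palette zero [] _ (x ∷ _) _ _ colours = case colours (here refl) of λ ()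
  length<2^palette (suc k) palette |palette| P@(_ ∷ _) u l colours
    with c , once ← conflict-free P (IsPath-∷ G u l)
    with A , v , B , P≡ , Cv≡c , A-avoids , B-avoids ← countColor-≡1-split C P once =
    subst (λ Q → length Q < 2 ^ suc k) (sym P≡)
      (length-++-∷-< A (half A (Unique-++⁻ˡ A u′) (Linked-++⁻ˡ A l′) (colours′ ∘ ∈-++⁺ˡ) A-avoids)
                       (half B (Unique-++⁻ʳ (v ∷ []) (Unique-++⁻ʳ A u′))
                               (Linked-++⁻ʳ (v ∷ []) (Linked-++⁻ʳ A l′))
                               (colours′ ∘ ∈-++⁺ʳ A ∘ there) B-avoids))
    where
      u′ : Unique (A ++ v ∷ B)
      u′ = subst Unique P≡ u
      l′ : Linked (Adj G) (A ++ v ∷ B)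
      l′ = subst (Linked (Adj G)) P≡ l
      colours′ : ∀ {y} → y ∈ A ++ v ∷ B → C y ∈ palette
      colours′ = colours ∘ subst (_ ∈_) (sym P≡)
      palette⁻ : List ℕ
      palette⁻ = filter (λ d → ¬? (d ≟ c)) palette
      |palette⁻| : length palette⁻ ≤ k
      |palette⁻| = ≤-pred (≤-trans (filter-notAll _ palette (lose (subst (_∈ palette) Cv≡c
                     (colours′ (∈-++⁺ʳ A (here refl)))) (λ ¬c≢c → ¬c≢c refl))) |palette|)
      half : ∀ Q → Unique Q → Linked (Adj G) Q → (∀ {y} → y ∈ Q → C y ∈ palette) →
             (∀ {y} → y ∈ Q → C y ≢ c) → length Q < 2 ^ k
      half Q uQ lQ coloursQ avoids =
        length<2^palette k palette⁻ |palette⁻| Q uQ lQ (λ y∈Q → ∈-filter⁺ _ (coloursQ y∈Q) (avoids y∈Q))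

module _ {n : ℕ} (G : Graph n) (adj? : Decidable (Adj G)) where

  open import Data.List.Membership.DecPropositional (Fin._≟_ {n}) using (_∈?_)

  -- The top of the stack p is its head: `kept` is the longest suffix of p whose head has a
  -- neighbour in U, and `root` is such a neighbour.
  record Attachment (U p : List (Fin n)) : Set where
    field
      root         : Fin n
      root∈U       : root ∈ U
      dropped kept : List (Fin n)
      p≡           : p ≡ dropped ++ kept
      root-linked  : Linked (Adj G) (root ∷ kept)
      kept-longest : ∀ A x s → p ≡ A ++ x ∷ s → ∀ {y} → y ∈ U → Adj G y x → length (x ∷ s) ≤ length kept

  attach : ∀ {U u₀} → u₀ ∈ U → ∀ p → Linked (Adj G) p → Attachment U p
  attach {u₀ = u₀} u₀∈U [] _ = record
    { root = u₀ ; root∈U = u₀∈U ; dropped = [] ; kept = [] ; p≡ = refl ; root-linked = [-]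
    ; kept-longest = λ { [] _ _ () ; (_ ∷ _) _ _ () } }
  attach {U} u₀∈U (x ∷ p) l with any? (λ y → adj? y x) U
  ... | yes neighbour with root , root∈U , root-x ← find neighbour = record
    { root = root ; root∈U = root∈U ; dropped = [] ; kept = x ∷ p ; p≡ = refl
    ; root-linked = root-x ∷ l
    ; kept-longest = λ A _ _ eq _ _ → subst ((_ ≤_) ∘ length) (sym eq) (length-≤-++ A) }
  ... | no no-neighbour = record
    { root = root ; root∈U = root∈U ; dropped = x ∷ dropped ; kept = kept
    ; p≡ = cong (x ∷_) p≡ ; root-linked = root-linked ; kept-longest = longest }
    where
      open Attachment (attach u₀∈U p (Linked.tail l))
      longest : ∀ A x′ s → x ∷ p ≡ A ++ x′ ∷ s → ∀ {y} → y ∈ U → Adj G y x′ → length (x′ ∷ s) ≤ length kept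
      longest []      _ _ refl y∈U yx = contradiction (lose y∈U yx) no-neighbour
      longest (_ ∷ A) _ s eq   y∈U yx = kept-longest A _ s (proj₂ (∷-injective eq)) y∈U yx

  -- Depths in a depth-first search forest of U hanging below the stack p, in which the stack
  -- vertex x of p ≡ A ++ x ∷ s sits at depth length (x ∷ s).
  record Ranking (U p : List (Fin n)) : Set where
    field
      depth      : Fin n → ℕ
      realised   : ∀ {v} → v ∈ U → ∃ λ π → IsPath G π × depth v ≡ length π
      unique-min : ∀ {P} → IsPath G P → P ⊆ U →
                   ∃ λ m → m ∈ P × ∀ {y} → y ∈ P → y ≢ m → depth m < depth y
      above      : ∀ {Q} → IsPath G Q → Q ⊆ U → ∀ A x s → p ≡ A ++ x ∷ s →
                   Any (λ y → Adj G y x) Q → ∀ {z} → z ∈ Q → length (x ∷ s) < depth z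

  ranking-[] : ∀ p → Ranking [] p
  ranking-[] p = record
    { depth      = λ _ → 0
    ; realised   = λ ()
    ; unique-min = λ { {[]}    P _    → contradiction refl (IsPath.nonempty P)
                     ; {_ ∷ _} _ P⊆[] → case P⊆[] (here refl) of λ () }
    ; above      = λ _ Q⊆[] _ _ _ _ _ z∈Q → case Q⊆[] z∈Q of λ () }

  module Push {U p} (p-unique : Unique p) (p∩U : Disjoint p U) (a : Attachment U p) where
    open Attachment a

    ≢root? : ∀ y → Dec (y ≢ root)
    ≢root? y = ¬? (y Fin.≟ root)

    U⁻ : List (Fin n)
    U⁻ = filter ≢root? U

    stack : List (Fin n)
    stack = root ∷ kept

    kept⊆p : kept ⊆ p
    kept⊆p = subst (_ ∈_) (sym p≡) ∘ ∈-++⁺ʳ dropped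

    stack-linked : Linked (Adj G) stack
    stack-linked = root-linked

    stack-unique : Unique stack
    stack-unique = Unique-∷ (λ root∈kept → p∩U (kept⊆p root∈kept , root∈U))
                            (Unique-++⁻ʳ dropped (subst Unique p≡ p-unique))

    stack∩U⁻ : Disjoint stack U⁻
    stack∩U⁻ (here refl , root∈U⁻)     = proj₂ (∈-filter⁻ ≢root? {xs = U} root∈U⁻) refl
    stack∩U⁻ (there x∈kept , x∈U⁻) = p∩U (kept⊆p x∈kept , proj₁ (∈-filter⁻ ≢root? {xs = U} x∈U⁻))

    U⁻-shorter : length U⁻ < length U
    U⁻-shorter = filter-notAll ≢root? U (lose root∈U (λ root≢root → root≢root refl))

    ⊆U⁻ : ∀ {Q} → Q ⊆ U → root ∉ Q → Q ⊆ U⁻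
    ⊆U⁻ Q⊆U root∉Q y∈Q = ∈-filter⁺ ≢root? (Q⊆U y∈Q) λ { refl → root∉Q y∈Q }

    neighbour-≤kept : ∀ {Q} → Q ⊆ U → ∀ A x s → p ≡ A ++ x ∷ s → Any (λ y → Adj G y x) Q →
                      length (x ∷ s) ≤ length kept
    neighbour-≤kept Q⊆U A x s p≡A++x∷s Q-x with y , y∈Q , yx ← find Q-x =
      kept-longest A x s p≡A++x∷s (Q⊆U y∈Q) yx

    module _ (r : Ranking U⁻ stack) where
      module R = Ranking r

      depth : Fin n → ℕ
      depth v with v Fin.≟ root
      ... | yes _ = length stack
      ... | no _  = R.depth v

      depth-root : depth root ≡ length stack
      depth-root with root Fin.≟ root
      ... | yes _        = refl
      ... | no root≢root = contradiction refl root≢root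

      depth-other : ∀ {v} → v ≢ root → depth v ≡ R.depth v
      depth-other {v} v≢root with v Fin.≟ root
      ... | yes v≡root = contradiction v≡root v≢root
      ... | no _       = refl

      beside-root : ∀ {P} → IsPath G P → P ⊆ U → root ∈ P → ∀ {z} → z ∈ P → z ≢ root →
                    length stack < depth z
      beside-root P P⊆U root∈P z∈P z≢root
        with Q , Q-path , z∈Q , Q⊆P , root∉Q , Q-root ← path-side G P root∈P z∈P z≢root =
        subst (length stack <_) (sym (depth-other z≢root))
              (R.above Q-path (⊆U⁻ (P⊆U ∘ Q⊆P) root∉Q) [] root kept refl Q-root z∈Q)

      realised : ∀ {v} → v ∈ U → ∃ λ π → IsPath G π × depth v ≡ length π
      realised {v} v∈U with v Fin.≟ root
      ... | yes refl  = stack , IsPath-∷ G stack-unique stack-linked , refl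
      ... | no v≢root = R.realised (∈-filter⁺ ≢root? v∈U v≢root)

      unique-min : ∀ {P} → IsPath G P → P ⊆ U →
                   ∃ λ m → m ∈ P × ∀ {y} → y ∈ P → y ≢ m → depth m < depth y
      unique-min {P} P-path P⊆U with root ∈? P
      ... | yes root∈P = root , root∈P , λ {y} y∈P y≢root →
              subst (_< depth y) (sym depth-root) (beside-root P-path P⊆U root∈P y∈P y≢root)
      ... | no root∉P =
        let m , m∈P , min = R.unique-min P-path (⊆U⁻ P⊆U root∉P) in
        m , m∈P , λ y∈P y≢m →
          subst₂ _<_ (sym (depth-other (avoids m∈P))) (sym (depth-other (avoids y∈P))) (min y∈P y≢m)
        where
          avoids : ∀ {y} → y ∈ P → y ≢ root
          avoids y∈P refl = root∉P y∈P

      above : ∀ {Q} → IsPath G Q → Q ⊆ U → ∀ A x s → p ≡ A ++ x ∷ s →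
              Any (λ y → Adj G y x) Q → ∀ {z} → z ∈ Q → length (x ∷ s) < depth z
      above {Q} Q-path Q⊆U A x s p≡A++x∷s Q-x {z} z∈Q with root ∈? Q
      ... | yes root∈Q = <-≤-trans (s≤s (neighbour-≤kept Q⊆U A x s p≡A++x∷s Q-x)) (stack≤ z z∈Q)
        where
          stack≤ : ∀ z → z ∈ Q → length stack ≤ depth z
          stack≤ z z∈Q = case z Fin.≟ root of λ
            { (yes refl)    → ≤-reflexive (sym depth-root)
            ; (no z≢root) → <⇒≤ (beside-root Q-path Q⊆U root∈Q z∈Q z≢root) }
      ... | no root∉Q =
        let B , kept≡ = ++-suffix-≤ dropped A (trans (sym p≡) p≡A++x∷s) (neighbour-≤kept Q⊆U A x s p≡A++x∷s Q-x) in
        subst (length (x ∷ s) <_) (sym (depth-other λ { refl → root∉Q z∈Q }))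
              (R.above Q-path (⊆U⁻ Q⊆U root∉Q) (root ∷ B) x s (cong (root ∷_) kept≡) Q-x z∈Q)

      extend : Ranking U p
      extend = record { depth = depth ; realised = realised ; unique-min = unique-min ; above = above }

  ranking : ∀ k U p → length U ≤ k → Unique p → Linked (Adj G) p → Disjoint p U → Ranking U p
  ranking _       []        p _   _        _        _   = ranking-[] p
  ranking zero    (_ ∷ _)   _ ()  _        _        _
  ranking (suc k) U@(_ ∷ _) p |U| p-unique p-linked p∩U =
    extend (ranking k U⁻ stack (≤-pred (≤-trans U⁻-shorter |U|)) stack-unique stack-linked stack∩U⁻)
    where open Push p-unique p∩U (attach (here refl) p p-linked)

  dfs-ranking : Ranking (allFin n) []
  dfs-ranking = ranking n (allFin n) [] (≤-reflexive (length-tabulate (λ i → i))) [] [] (λ { (() , _) })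

∈-applyUpTo-suc : ∀ {c k} → 1 ≤ c × c ≤ k → c ∈ applyUpTo suc k
∈-applyUpTo-suc {suc i} (_ , i<k) = ∈-applyUpTo⁺ suc i<k

module _ {n : ℕ} (G : Graph n) where

  path-length<2^k : ∀ {k C} → IsCFColoring G k C → ∀ {P} → IsPath G P → length P < 2 ^ k
  path-length<2^k {k} {C} (in-range , conflict-free) {P} P-path =
    length<2^palette G C conflict-free k (applyUpTo suc k) (≤-reflexive (length-applyUpTo suc k))
                     P (IsPath.distinct P-path) (IsPath.linked P-path) (λ {v} _ → ∈-applyUpTo-suc (in-range v))

  umColoring : Decidable (Adj G) → ∀ {k C} → IsCFColoring G k C → ∃ λ C′ → IsUMColoring G (2 ^ k ∸ 1) C′
  umColoring adj? {k} cf = colour , in-range , unique-max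
    where
      open Ranking (dfs-ranking G adj?)

      short : ∀ v → depth v < 2 ^ k
      short v with π , π-path , depth≡ ← realised (∈-allFin v) =
        subst (_< 2 ^ k) (sym depth≡) (path-length<2^k cf π-path)

      positive : ∀ v → 1 ≤ depth v
      positive v with π , π-path , depth≡ ← realised (∈-allFin v) =
        subst (1 ≤_) (sym depth≡) (IsPath-length>0 G π-path)

      colour : Fin n → ℕ
      colour v = 2 ^ k ∸ depth v

      in-range : UsesColors (2 ^ k ∸ 1) colour
      in-range v = m<n⇒0<n∸m (short v) , ∸-monoʳ-≤ (2 ^ k) (positive v)

      unique-max : ∀ P → IsPath G P → countColor colour (maxColor colour P) P ≡ 1
      unique-max P P-path =
        let m , m∈P , min = unique-min P-path (λ {v} _ → ∈-allFin v) in
        countColor-maxColor colour P (IsPath.distinct P-path) m∈P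
          (λ {y} y∈P y≢m → ∸-monoʳ-< (min y∈P y≢m) (<⇒≤ (short y)))

¬¬-decidable : ∀ {n} (R : Fin n → Fin n → Set) → ¬ ¬ Decidable R
¬¬-decidable R = sequence rawApplicative λ u → sequence rawApplicative λ v → ¬¬-excluded-middle
  where open RawMonad ¬¬-Monad using (rawApplicative)

proposition4 : (n : ℕ) (G : Graph n) (a b : ℕ) →
    IsχUM G a → IsχCF G b → a ≤ (2 ^ b) ∸ 1
proposition4 n G a b (_ , a-minimal) ((C , cf) , _) =
  decidable-stable (a ≤? 2 ^ b ∸ 1)
    (¬¬-map (λ adj? → a-minimal (2 ^ b ∸ 1) (umColoring G adj? cf)) (¬¬-decidable (Adj G)))
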